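{- For every $n\ge1$, the number of integer sequences $e=(e_1,\dots,e_n)$ with $0\le e_i<i$ for all $i$ having no indices $i<j<k$ with $e_i\ge e_j\ge e_k$ equals the number of such sequences having no indices $i<j<k$ with $e_j\le e_k$ and $e_i\ge e_k$. -}

module Defs where

open import Data.Nat using (ℕ; zero; suc; _≤_; _<_; _≥_)
open import Data.Fin using (Fin; toℕ)
open import Data.Vec using (Vec; lookup)
open import Data.Product using (Σ; _×_)
open import Relation.Nullary using (¬_)

-- Stored as a vector of naturals; positions are 0-indexed, so position
-- i : Fin n holds e_{i+1} and the constraint e_{i+1} < i+1 reads
-- lookup e i < suc (toℕ i).
IsInvSeq : ∀ {n} → Vec ℕ n → Set
IsInvSeq {n} e = (i : Fin n) → lookup e i < suc (toℕ i)

HasPattern210 : ∀ {n} → Vec ℕ n → Set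
HasPattern210 {n} e =
  Σ (Fin n) λ i → Σ (Fin n) λ j → Σ (Fin n) λ k →
    (toℕ i < toℕ j) × (toℕ j < toℕ k) ×
    (lookup e i ≥ lookup e j) × (lookup e j ≥ lookup e k)

HasPatternB : ∀ {n} → Vec ℕ n → Set
HasPatternB {n} e =
  Σ (Fin n) λ i → Σ (Fin n) λ j → Σ (Fin n) λ k →
    (toℕ i < toℕ j) × (toℕ j < toℕ k) ×
    (lookup e j ≤ lookup e k) × (lookup e i ≥ lookup e k)

-- The set of inversion sequences of length n satisfying a property P.
-- Proof fields are irrelevant, so an element is determined by its vector:
-- two elements are equal (≡) iff their underlying sequences are equal.
record InvSeqWith (n : ℕ) (P : Vec ℕ n → Set) : Set where
  constructor mk
  field
    seq : Vec ℕ n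
    .isInv : IsInvSeq seq
    .prop : P seq

Avoid210 : ℕ → Set
Avoid210 n = InvSeqWith n (λ e → ¬ HasPattern210 e)

AvoidB : ℕ → Set
AvoidB n = InvSeqWith n (λ e → ¬ HasPatternB e)

-- Read an inversion sequence from left to right, and let m be one more than the maximum of the
-- prefix read so far. A next entry z creates no weak 210 iff z ≥ a, where a - 1 is the largest
-- entry preceded by a weakly larger one; it creates no pattern B iff z lies in no interval
-- [e_j, e_i] with i < j. Every z ≥ m is allowed on both sides. The bijection keeps entries ≥ m and
-- sends the entry a + t < m to the t-th largest (from 0) allowed value, a "gap", below m on the B side.
-- Inductively both prefixes have the same maximum and the B side has exactly m - a gaps below m:
-- choosing c = a + t < m raises a to c + 1, while the chosen gap y, together with an earlier entry
-- at least y, forbids every gap ≥ y and leaves the m - c - 1 smaller ones; choosing c ≥ m raises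
-- m to c + 1 and adds m, …, c to the gaps. The inverse reads off the rank of a gap.
module Submission where

open import Defs
open import Data.Nat using (ℕ; zero; suc; _+_; _∸_; _⊔_; _≤_; _<_; _≥_; _>_; z≤n; s≤s; _<?_; _≤?_; _≟_)
open import Data.Nat.Properties
open import Data.Fin using (Fin; zero; suc; toℕ; opposite)
open import Data.Fin.Properties using (toℕ<n; opposite-prop; opposite-suc; opposite-involutive)
open import Data.Vec using (Vec; []; _∷_; lookup; tabulate)
open import Data.Vec.Properties using (≡-dec; lookup∘tabulate; tabulate∘lookup; tabulate-cong)
open import Data.List using (List; []; _∷_; _++_; drop; length; applyDownFrom)
open import Data.List.Properties using (length-++; length-drop; length-applyDownFrom)
open import Data.List.Membership.Propositional using (_∈_)
open import Data.List.Membership.Propositional.Properties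
  using (∈-++⁺ˡ; ∈-++⁺ʳ; ∈-++⁻; ∈-applyDownFrom⁺; ∈-applyDownFrom⁻)
open import Data.List.Relation.Unary.Any using (here; there)
open import Data.List.Relation.Unary.All as All using (All; [])
open import Data.List.Relation.Unary.AllPairs using (AllPairs; []; _∷_)
import Data.List.Relation.Unary.All.Properties as All
import Data.List.Relation.Unary.AllPairs.Properties as AllPairs
open import Data.Product using (Σ; ∃; _×_; _,_; proj₁; proj₂)
open import Data.Sum using (_⊎_; inj₁; inj₂)
open import Data.Empty using (⊥; ⊥-elim)
open import Data.Unit using (⊤; tt)
open import Function using (_∘_)
open import Function.Bundles using (_↔_; mk↔ₛ′)
open import Relation.Nullary using (¬_; yes; no)
open import Relation.Nullary.Decidable using (recompute)
open import Relation.Binary.PropositionalEquality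

private
  variable
    n : ℕ

Pattern : Set₁
Pattern = ℕ → ℕ → ℕ → Set

Weak210 : Pattern
Weak210 x y z = x ≥ y × y ≥ z

PatternB : Pattern
PatternB x y z = y ≤ z × x ≥ z

Occurs : Pattern → Vec ℕ n → Set
Occurs {n} R e = Σ (Fin n) λ i → Σ (Fin n) λ j → Σ (Fin n) λ k →
  (toℕ i < toℕ j) × (toℕ j < toℕ k) × R (lookup e i) (lookup e j) (lookup e k)

resp₃ : ∀ (R : Pattern) {x y z x′ y′ z′} → x ≡ x′ → y ≡ y′ → z ≡ z′ → R x y z → R x′ y′ z′
resp₃ R refl refl refl p = p

rev : Vec ℕ n → Vec ℕ n
rev e = tabulate (lookup e ∘ opposite)

lookup-rev : ∀ (e : Vec ℕ n) i → lookup (rev e) i ≡ lookup e (opposite i)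
lookup-rev e = lookup∘tabulate (lookup e ∘ opposite)

rev-involutive : ∀ (e : Vec ℕ n) → rev (rev e) ≡ e
rev-involutive e = begin
  tabulate (lookup (rev e) ∘ opposite) ≡⟨ tabulate-cong lookup-rev-opposite ⟩
  tabulate (lookup e)                  ≡⟨ tabulate∘lookup e ⟩
  e                                    ∎
  where
  open ≡-Reasoning
  lookup-rev-opposite : ∀ i → lookup (rev e) (opposite i) ≡ lookup e i
  lookup-rev-opposite i = trans (lookup-rev e (opposite i)) (cong (lookup e) (opposite-involutive i))

opposite-reverses-< : ∀ (i j : Fin n) → toℕ i < toℕ j → toℕ (opposite j) < toℕ (opposite i)
opposite-reverses-< i j i<j rewrite opposite-prop i | opposite-prop j = ∸-monoʳ-< (s≤s i<j) (toℕ<n j)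

OccursRev : Pattern → Vec ℕ n → Set
OccursRev {n} R r = Σ (Fin n) λ i → Σ (Fin n) λ j → Σ (Fin n) λ k →
  (toℕ k < toℕ j) × (toℕ j < toℕ i) × R (lookup r i) (lookup r j) (lookup r k)

occursRev-rev⁻ : ∀ R (e : Vec ℕ n) → OccursRev R (rev e) → Occurs R e
occursRev-rev⁻ R e (i , j , k , k<j , j<i , p) =
  opposite i , opposite j , opposite k ,
  opposite-reverses-< j i j<i , opposite-reverses-< k j k<j ,
  resp₃ R (lookup-rev e i) (lookup-rev e j) (lookup-rev e k) p

occurs-rev⁻ : ∀ R (r : Vec ℕ n) → Occurs R (rev r) → OccursRev R r
occurs-rev⁻ R r (i , j , k , i<j , j<k , p) =
  opposite i , opposite j , opposite k ,
  opposite-reverses-< j k j<k , opposite-reverses-< i j i<j ,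
  resp₃ R (lookup-rev r i) (lookup-rev r j) (lookup-rev r k) p

-- r lists earlier entries, most recent first; z completes an occurrence (x, y, z) of R
-- whose entries x, y are taken from r in this order of the sequence.
Completes : Pattern → Vec ℕ n → ℕ → Set
Completes R [] z = ⊥
Completes R (y ∷ r) z = (∃ λ i → R (lookup r i) y z) ⊎ Completes R r z

-- r lists an inversion sequence from its last entry backwards, and no entry completes an occurrence of R.
Avoiding : Pattern → Vec ℕ n → Set
Avoiding R [] = ⊤
Avoiding {suc n} R (c ∷ r) = c ≤ n × ¬ Completes R r c × Avoiding R r

completes⁻ : ∀ R (r : Vec ℕ n) {z} → Completes R r z →
             Σ (Fin n) λ i → Σ (Fin n) λ j → toℕ j < toℕ i × R (lookup r i) (lookup r j) z
completes⁻ R (y ∷ r) (inj₁ (i , p)) = suc i , zero , s≤s z≤n , p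
completes⁻ R (y ∷ r) (inj₂ q) with completes⁻ R r q
... | i , j , j<i , p = suc i , suc j , s≤s j<i , p

completes⁺ : ∀ R (r : Vec ℕ n) {z} (i j : Fin n) → toℕ j < toℕ i →
             R (lookup r i) (lookup r j) z → Completes R r z
completes⁺ R (y ∷ r) (suc i) zero    _         p = inj₁ (i , p)
completes⁺ R (y ∷ r) (suc i) (suc j) (s≤s j<i) p = inj₂ (completes⁺ R r i j j<i p)

occursRev-∷⁻ : ∀ R (r : Vec ℕ n) {c} → OccursRev R (c ∷ r) → OccursRev R r ⊎ Completes R r c
occursRev-∷⁻ R r (suc i , suc j , zero  , _ , s≤s j<i , p) = inj₂ (completes⁺ R r i j j<i p)
occursRev-∷⁻ R r (suc i , suc j , suc k , s≤s k<j , s≤s j<i , p) = inj₁ (i , j , k , k<j , j<i , p)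

occursRev-∷⁺ : ∀ R (r : Vec ℕ n) {c} → OccursRev R r → OccursRev R (c ∷ r)
occursRev-∷⁺ R r (i , j , k , k<j , j<i , p) = suc i , suc j , suc k , s≤s k<j , s≤s j<i , p

completes⇒occursRev : ∀ R (r : Vec ℕ n) {c} → Completes R r c → OccursRev R (c ∷ r)
completes⇒occursRev R r q with completes⁻ R r q
... | i , j , j<i , p = suc i , suc j , zero , s≤s z≤n , s≤s j<i , p

BoundedRev : Vec ℕ n → Set
BoundedRev r = ∀ i → lookup r i < suc (toℕ (opposite i))

boundedRev-∷⁻ : ∀ c (r : Vec ℕ n) → BoundedRev (c ∷ r) → c ≤ n × BoundedRev r
boundedRev-∷⁻ c r b =
  ≤-pred (subst (λ t → c < suc t) (opposite-prop zero) (b zero)) ,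
  λ i → subst (λ t → lookup r i < suc t) (opposite-suc i) (b (suc i))

boundedRev-∷⁺ : ∀ c (r : Vec ℕ n) → c ≤ n → BoundedRev r → BoundedRev (c ∷ r)
boundedRev-∷⁺ c r c≤n b zero    = s≤s (subst (c ≤_) (sym (opposite-prop zero)) c≤n)
boundedRev-∷⁺ c r c≤n b (suc i) = subst (λ t → lookup r i < suc t) (sym (opposite-suc i)) (b i)

avoiding⁺ : ∀ R (r : Vec ℕ n) → BoundedRev r → ¬ OccursRev R r → Avoiding R r
avoiding⁺ R []      _ _ = tt
avoiding⁺ R (c ∷ r) b ¬o with boundedRev-∷⁻ c r b
... | c≤n , b′ = c≤n , ¬o ∘ completes⇒occursRev R r , avoiding⁺ R r b′ (¬o ∘ occursRev-∷⁺ R r)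

avoiding⇒boundedRev : ∀ R (r : Vec ℕ n) → Avoiding R r → BoundedRev r
avoiding⇒boundedRev R []      _              ()
avoiding⇒boundedRev R (c ∷ r) (c≤n , _ , av) = boundedRev-∷⁺ c r c≤n (avoiding⇒boundedRev R r av)

avoiding⇒¬occursRev : ∀ R (r : Vec ℕ n) → Avoiding R r → ¬ OccursRev R r
avoiding⇒¬occursRev R (c ∷ r) (_ , ¬q , av) o with occursRev-∷⁻ R r o
... | inj₁ o′ = avoiding⇒¬occursRev R r av o′
... | inj₂ q  = ¬q q

avoiding-rev : ∀ R (e : Vec ℕ n) → IsInvSeq e → ¬ Occurs R e → Avoiding R (rev e)
avoiding-rev R e inv ¬o = avoiding⁺ R (rev e)
  (λ i → subst (_< suc (toℕ (opposite i))) (sym (lookup-rev e i)) (inv (opposite i)))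
  (¬o ∘ occursRev-rev⁻ R e)

rev-avoiding : ∀ R (r : Vec ℕ n) → Avoiding R r → IsInvSeq (rev r) × ¬ Occurs R (rev r)
rev-avoiding R r av =
  (λ i → subst₂ (λ x t → x < suc t) (sym (lookup-rev r i)) (cong toℕ (opposite-involutive i))
                (avoiding⇒boundedRev R r av (opposite i))) ,
  avoiding⇒¬occursRev R r av ∘ occurs-rev⁻ R r

height : Vec ℕ n → ℕ
height []      = 0
height (c ∷ r) = suc c ⊔ height r

≤lookup⇒<height : ∀ (r : Vec ℕ n) i {t} → t ≤ lookup r i → t < height r
≤lookup⇒<height (c ∷ r) zero    t≤c = ≤-trans (s≤s t≤c) (m≤m⊔n (suc c) (height r))
≤lookup⇒<height (c ∷ r) (suc i) t≤ = ≤-trans (≤lookup⇒<height r i t≤) (m≤n⊔m (suc c) (height r))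

<height⇒≤lookup : ∀ (r : Vec ℕ n) {t} → t < height r → ∃ λ i → t ≤ lookup r i
<height⇒≤lookup (c ∷ r) {t} t< with t ≤? c | t <? height r
... | yes t≤c | _     = zero , t≤c
... | no  _   | yes t<h with <height⇒≤lookup r t<h
...   | i , t≤ = suc i , t≤
<height⇒≤lookup (c ∷ r) {t} t< | no t≰c | no t≮h = ⊥-elim (<⇒≱ t< (⊔-lub (≰⇒> t≰c) (≮⇒≥ t≮h)))

avoiding⇒height≤ : ∀ R (r : Vec ℕ n) → Avoiding R r → height r ≤ n
avoiding⇒height≤ R []      _              = z≤n
avoiding⇒height≤ R (c ∷ r) (c≤n , _ , av) = ⊔-lub (s≤s c≤n) (m≤n⇒m≤1+n (avoiding⇒height≤ R r av))

completesB⇒<height : ∀ (o : Vec ℕ n) {z} → Completes PatternB o z → z < height o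
completesB⇒<height o q with completes⁻ PatternB o q
... | i , _ , _ , _ , z≤oᵢ = ≤lookup⇒<height o i z≤oᵢ

completesB-∷⇒<height : ∀ y (o : Vec ℕ n) {z} → Completes PatternB (y ∷ o) z → z < height o
completesB-∷⇒<height y o (inj₁ (i , _ , z≤oᵢ)) = ≤lookup⇒<height o i z≤oᵢ
completesB-∷⇒<height y o (inj₂ q)              = completesB⇒<height o q

Decreasing : List ℕ → Set
Decreasing = AllPairs _>_

-- nth xs j is 0 for j ≥ length xs.
nth : List ℕ → ℕ → ℕ
nth []       _       = 0
nth (x ∷ xs) zero    = x
nth (x ∷ xs) (suc j) = nth xs j

position : ℕ → List ℕ → ℕ
position y []       = 0
position y (x ∷ xs) with y ≟ x
... | yes _ = 0
... | no  _ = suc (position y xs)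

nth-∈ : ∀ xs {j} → j < length xs → nth xs j ∈ xs
nth-∈ (x ∷ xs) {zero}  _         = here refl
nth-∈ (x ∷ xs) {suc j} (s≤s j<) = there (nth-∈ xs j<)

position-nth : ∀ xs {j} → Decreasing xs → j < length xs → position (nth xs j) xs ≡ j
position-nth (x ∷ xs) {zero} _ _ with x ≟ x
... | yes _   = refl
... | no  x≢x = ⊥-elim (x≢x refl)
position-nth (x ∷ xs) {suc j} (x>xs ∷ dec) (s≤s j<) with nth xs j ≟ x
... | yes y≡x = ⊥-elim (<-irrefl y≡x (All.lookup x>xs (nth-∈ xs j<)))
... | no  _   = cong suc (position-nth xs dec j<)

nth-position : ∀ xs {y} → y ∈ xs → nth xs (position y xs) ≡ y × position y xs < length xs
nth-position (x ∷ xs) {y} y∈ with y ≟ x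
... | yes y≡x = sym y≡x , s≤s z≤n
nth-position (x ∷ xs) (here y≡x) | no y≢x = ⊥-elim (y≢x y≡x)
nth-position (x ∷ xs) (there y∈) | no _ with nth-position xs y∈
... | nth≡y , pos< = nth≡y , s≤s pos<

∈-drop⁻ : ∀ k (xs : List ℕ) {z} → z ∈ drop k xs → z ∈ xs
∈-drop⁻ zero    xs       z∈ = z∈
∈-drop⁻ (suc k) (x ∷ xs) z∈ = there (∈-drop⁻ k xs z∈)

∈-drop-suc⇒<nth : ∀ xs {j z} → Decreasing xs → j < length xs → z ∈ drop (suc j) xs → z < nth xs j
∈-drop-suc⇒<nth (x ∷ xs) {zero}  (x>xs ∷ _)   _        z∈ = All.lookup x>xs z∈
∈-drop-suc⇒<nth (x ∷ xs) {suc j} (_ ∷ dec) (s≤s j<) z∈ = ∈-drop-suc⇒<nth xs dec j< z∈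

<nth⇒∈-drop-suc : ∀ xs {j z} → Decreasing xs → j < length xs → z ∈ xs → z < nth xs j →
                  z ∈ drop (suc j) xs
<nth⇒∈-drop-suc (x ∷ xs) {zero}  _           _        (here refl) z<x = ⊥-elim (<-irrefl refl z<x)
<nth⇒∈-drop-suc (x ∷ xs) {zero}  _           _        (there z∈)  _   = z∈
<nth⇒∈-drop-suc (x ∷ xs) {suc j} (x>xs ∷ _)   (s≤s j<) (here refl) z<  =
  ⊥-elim (<-asym z< (All.lookup x>xs (nth-∈ xs j<)))
<nth⇒∈-drop-suc (x ∷ xs) {suc j} (_ ∷ dec)   (s≤s j<) (there z∈)  z<  = <nth⇒∈-drop-suc xs dec j< z∈ z<

∈-applyDownFrom-+⁻ : ∀ m k {z} → z ∈ applyDownFrom (m +_) k → m ≤ z × z < m + k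
∈-applyDownFrom-+⁻ m k z∈ with ∈-applyDownFrom⁻ (m +_) z∈
... | i , i<k , refl = m≤m+n m i , +-monoʳ-< m i<k

∈-applyDownFrom-+⁺ : ∀ m k {z} → m ≤ z → z < m + k → z ∈ applyDownFrom (m +_) k
∈-applyDownFrom-+⁺ m k {z} m≤z z< =
  subst (_∈ applyDownFrom (m +_) k) (m+[n∸m]≡n m≤z)
        (∈-applyDownFrom⁺ (m +_) (+-cancelˡ-< m (z ∸ m) k (subst (_< m + k) (sym (m+[n∸m]≡n m≤z)) z<)))

applyDownFrom-+-decreasing : ∀ m k → Decreasing (applyDownFrom (m +_) k)
applyDownFrom-+-decreasing m k = AllPairs.applyDownFrom⁺₁ (m +_) k (λ j<i _ → +-monoʳ-< m j<i)

record State : Set where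
  constructor state
  field
    top floor : ℕ
    gaps      : List ℕ

open State

step : State → ℕ → State
step (state m a F) c with c <? m
... | yes _ = state m (suc c) (drop (suc (c ∸ a)) F)
... | no  _ = state (suc c) a (applyDownFrom (m +_) (suc c ∸ m) ++ F)

encode : State → ℕ → ℕ
encode (state m a F) c with c <? m
... | yes _ = nth F (c ∸ a)
... | no  _ = c

decode : State → ℕ → ℕ
decode (state m a F) y with y <? m
... | yes _ = a + position y F
... | no  _ = y

stateOf : Vec ℕ n → State
stateOf []      = state 0 0 []
stateOf (c ∷ r) = step (stateOf r) c

toB : Vec ℕ n → Vec ℕ n
toB []      = []
toB (c ∷ r) = encode (stateOf r) c ∷ toB r

to210 : Vec ℕ n → Vec ℕ n
to210 []      = []
to210 (y ∷ o) = decode (stateOf (to210 o)) y ∷ to210 o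

record Tracks (r o : Vec ℕ n) (s : State) : Set where
  field
    top≡heightʳ      : top s ≡ height r
    top≡heightᵒ      : top s ≡ height o
    completes⇒<floor : ∀ {z} → Completes Weak210 r z → z < floor s
    <floor⇒completes : ∀ {z} → z < floor s → Completes Weak210 r z
    gap⇒¬completes   : ∀ {z} → z ∈ gaps s → ¬ Completes PatternB o z
    ¬completes⇒gap   : ∀ {z} → z < top s → ¬ Completes PatternB o z → z ∈ gaps s
    gaps<top         : All (_< top s) (gaps s)
    gaps-decreasing  : Decreasing (gaps s)
    floor+gaps≡top   : floor s + length (gaps s) ≡ top s

tracks-[] : Tracks [] [] (state 0 0 [])
tracks-[] = record
  { top≡heightʳ = refl ; top≡heightᵒ = refl
  ; completes⇒<floor = λ () ; <floor⇒completes = λ ()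
  ; gap⇒¬completes = λ () ; ¬completes⇒gap = λ ()
  ; gaps<top = [] ; gaps-decreasing = [] ; floor+gaps≡top = refl }

suc+remaining≡ : ∀ {a c m L} → a ≤ c → c ∸ a < L → a + L ≡ m → suc c + (L ∸ suc (c ∸ a)) ≡ m
suc+remaining≡ {a} {c} {m} {L} a≤c j<L a+L≡m = begin
  suc c + (L ∸ suc j)         ≡⟨ cong (λ t → suc t + (L ∸ suc j)) (sym (m+[n∸m]≡n a≤c)) ⟩
  suc (a + j) + (L ∸ suc j)   ≡⟨ cong (_+ (L ∸ suc j)) (sym (+-suc a j)) ⟩
  a + suc j + (L ∸ suc j)     ≡⟨ +-assoc a (suc j) (L ∸ suc j) ⟩
  a + (suc j + (L ∸ suc j))   ≡⟨ cong (a +_) (m+[n∸m]≡n j<L) ⟩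
  a + L                       ≡⟨ a+L≡m ⟩
  m                           ∎
  where
  open ≡-Reasoning
  j = c ∸ a

offset<length-gaps : ∀ {r o : Vec ℕ n} {m a F c} → Tracks r o (state m a F) → a ≤ c → c < m →
                     c ∸ a < length F
offset<length-gaps {a = a} {c = c} T a≤c c<m =
  +-cancelˡ-< a (c ∸ a) _ (subst₂ _<_ (sym (m+[n∸m]≡n a≤c)) (sym (Tracks.floor+gaps≡top T)) c<m)

-- Below the top, c raises the floor to c + 1, and y = nth F (c ∸ a) covers every gap from y up.
tracks-below : ∀ {r o : Vec ℕ n} {m a F c} → Tracks r o (state m a F) → a ≤ c → c < m →
               Tracks (c ∷ r) (nth F (c ∸ a) ∷ o) (state m (suc c) (drop (suc (c ∸ a)) F))
tracks-below {r = r} {o} {m} {a} {F} {c} T a≤c c<m = record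
  { top≡heightʳ      = trans top≡heightʳ (sym (m≤n⇒m⊔n≡n (subst (suc c ≤_) top≡heightʳ c<m)))
  ; top≡heightᵒ      = trans top≡heightᵒ (sym (m≤n⇒m⊔n≡n (subst (suc y ≤_) top≡heightᵒ y<m)))
  ; completes⇒<floor = completes⇒<suc-c
  ; <floor⇒completes = <suc-c⇒completes
  ; gap⇒¬completes   = gap⇒¬completes′
  ; ¬completes⇒gap   = ¬completes⇒gap′
  ; gaps<top         = All.drop⁺ (suc j) gaps<top
  ; gaps-decreasing  = AllPairs.drop⁺ (suc j) gaps-decreasing
  ; floor+gaps≡top   = trans (cong (suc c +_) (length-drop (suc j) F))
                             (suc+remaining≡ a≤c j<L floor+gaps≡top)
  }
  where
  open Tracks T
  j = c ∸ a
  y = nth F j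
  j<L : j < length F
  j<L = offset<length-gaps T a≤c c<m
  y<m : y < m
  y<m = All.lookup gaps<top (nth-∈ F j<L)

  completes⇒<suc-c : ∀ {z} → Completes Weak210 (c ∷ r) z → z < suc c
  completes⇒<suc-c (inj₁ (_ , _ , z≤c)) = s≤s z≤c
  completes⇒<suc-c (inj₂ q)             = ≤-trans (completes⇒<floor q) (m≤n⇒m≤1+n a≤c)

  <suc-c⇒completes : ∀ {z} → z < suc c → Completes Weak210 (c ∷ r) z
  <suc-c⇒completes z<sc with <height⇒≤lookup r (subst (c <_) top≡heightʳ c<m)
  ... | i , c≤rᵢ = inj₁ (i , c≤rᵢ , ≤-pred z<sc)

  gap⇒¬completes′ : ∀ {z} → z ∈ drop (suc j) F → ¬ Completes PatternB (y ∷ o) z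
  gap⇒¬completes′ z∈ (inj₁ (_ , y≤z , _)) = <⇒≱ (∈-drop-suc⇒<nth F gaps-decreasing j<L z∈) y≤z
  gap⇒¬completes′ z∈ (inj₂ q)             = gap⇒¬completes (∈-drop⁻ (suc j) F z∈) q

  ¬completes⇒gap′ : ∀ {z} → z < m → ¬ Completes PatternB (y ∷ o) z → z ∈ drop (suc j) F
  ¬completes⇒gap′ {z} z<m ¬q with y ≤? z
  ... | yes y≤z with <height⇒≤lookup o (subst (z <_) top≡heightᵒ z<m)
  ...   | i , z≤oᵢ = ⊥-elim (¬q (inj₁ (i , y≤z , z≤oᵢ)))
  ¬completes⇒gap′ {z} z<m ¬q | no y≰z =
    <nth⇒∈-drop-suc F gaps-decreasing j<L (¬completes⇒gap z<m (¬q ∘ inj₂)) (≰⇒> y≰z)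

-- At or above the top, c exceeds every earlier entry, so it is never the middle of a new occurrence,
-- and m, …, c become gaps.
tracks-above : ∀ {r o : Vec ℕ n} {m a F c} → Tracks r o (state m a F) → ¬ c < m →
               Tracks (c ∷ r) (c ∷ o) (state (suc c) a (applyDownFrom (m +_) (suc c ∸ m) ++ F))
tracks-above {r = r} {o} {m} {a} {F} {c} T c≮m = record
  { top≡heightʳ      = sym (m≥n⇒m⊔n≡m (subst (_≤ suc c) top≡heightʳ m≤sc))
  ; top≡heightᵒ      = sym (m≥n⇒m⊔n≡m (subst (_≤ suc c) top≡heightᵒ m≤sc))
  ; completes⇒<floor = completes⇒<floor′
  ; <floor⇒completes = inj₂ ∘ <floor⇒completes
  ; gap⇒¬completes   = gap⇒¬completes′
  ; ¬completes⇒gap   = ¬completes⇒gap′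
  ; gaps<top         = All.++⁺ (All.tabulate (λ {z} z∈ → subst (z <_) m+k≡sc (proj₂ (new⁻ z∈))))
                               (All.map (λ z<m → ≤-trans z<m m≤sc) gaps<top)
  ; gaps-decreasing  = AllPairs.++⁺ (applyDownFrom-+-decreasing m k) gaps-decreasing
                         (All.tabulate (λ x∈ → All.map (λ w<m → <-≤-trans w<m (proj₁ (new⁻ x∈))) gaps<top))
  ; floor+gaps≡top   = floor+gaps≡top′
  }
  where
  open Tracks T
  m≤c : m ≤ c
  m≤c = ≮⇒≥ c≮m
  m≤sc : m ≤ suc c
  m≤sc = m≤n⇒m≤1+n m≤c
  k = suc c ∸ m
  new = applyDownFrom (m +_) k
  m+k≡sc : m + k ≡ suc c
  m+k≡sc = m+[n∸m]≡n m≤sc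
  new⁻ : ∀ {z} → z ∈ new → m ≤ z × z < m + k
  new⁻ = ∈-applyDownFrom-+⁻ m k

  completes⇒<floor′ : ∀ {z} → Completes Weak210 (c ∷ r) z → z < a
  completes⇒<floor′ (inj₁ (i , c≤rᵢ , _)) =
    ⊥-elim (c≮m (subst (c <_) (sym top≡heightʳ) (≤lookup⇒<height r i c≤rᵢ)))
  completes⇒<floor′ (inj₂ q)              = completes⇒<floor q

  gap⇒¬completes′ : ∀ {z} → z ∈ new ++ F → ¬ Completes PatternB (c ∷ o) z
  gap⇒¬completes′ z∈ q with ∈-++⁻ new z∈
  ... | inj₁ z∈new = <⇒≱ (subst (_ <_) (sym top≡heightᵒ) (completesB-∷⇒<height c o q)) (proj₁ (new⁻ z∈new))
  gap⇒¬completes′ z∈ (inj₁ (_ , c≤z , _)) | inj₂ z∈F = <⇒≱ (All.lookup gaps<top z∈F) (≤-trans m≤c c≤z)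
  gap⇒¬completes′ z∈ (inj₂ q)             | inj₂ z∈F = gap⇒¬completes z∈F q

  ¬completes⇒gap′ : ∀ {z} → z < suc c → ¬ Completes PatternB (c ∷ o) z → z ∈ new ++ F
  ¬completes⇒gap′ {z} z<sc ¬q with z <? m
  ... | yes z<m = ∈-++⁺ʳ new (¬completes⇒gap z<m (¬q ∘ inj₂))
  ... | no  z≮m = ∈-++⁺ˡ (∈-applyDownFrom-+⁺ m k (≮⇒≥ z≮m) (subst (z <_) (sym m+k≡sc) z<sc))

  floor+gaps≡top′ : a + length (new ++ F) ≡ suc c
  floor+gaps≡top′ = begin
    a + length (new ++ F)        ≡⟨ cong (a +_) (length-++ new) ⟩
    a + (length new + length F)  ≡⟨ cong (λ t → a + (t + length F)) (length-applyDownFrom (m +_) k) ⟩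
    a + (k + length F)           ≡⟨ sym (+-assoc a k (length F)) ⟩
    a + k + length F             ≡⟨ cong (_+ length F) (+-comm a k) ⟩
    k + a + length F             ≡⟨ +-assoc k a (length F) ⟩
    k + (a + length F)           ≡⟨ cong (k +_) floor+gaps≡top ⟩
    k + m                        ≡⟨ +-comm k m ⟩
    m + k                        ≡⟨ m+k≡sc ⟩
    suc c                        ∎
    where open ≡-Reasoning

tracks-step : ∀ {r o : Vec ℕ n} s {c} → Tracks r o s → floor s ≤ c →
              Tracks (c ∷ r) (encode s c ∷ o) (step s c)
tracks-step (state m a F) {c} T a≤c with c <? m
... | yes c<m = tracks-below T a≤c c<m
... | no  c≮m = tracks-above T c≮m

encode-admissible : ∀ {r o : Vec ℕ n} s {c} → Tracks r o s → floor s ≤ c → top s ≤ n → c ≤ n →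
                    encode s c ≤ n × ¬ Completes PatternB o (encode s c)
encode-admissible (state m a F) {c} T a≤c m≤n c≤n with c <? m
... | yes c<m = <⇒≤ (<-≤-trans (All.lookup (Tracks.gaps<top T) y∈F) m≤n) , Tracks.gap⇒¬completes T y∈F
  where y∈F = nth-∈ F (offset<length-gaps T a≤c c<m)
... | no  c≮m = c≤n , λ q → c≮m (subst (c <_) (sym (Tracks.top≡heightᵒ T)) (completesB⇒<height _ q))

decode-encode : ∀ {r o : Vec ℕ n} s {c} → Tracks r o s → floor s ≤ c → decode s (encode s c) ≡ c
decode-encode (state m a F) {c} T a≤c with c <? m
... | no c≮m with c <? m
...   | yes c<m = ⊥-elim (c≮m c<m)
...   | no  _   = refl
decode-encode (state m a F) {c} T a≤c | yes c<m with nth F (c ∸ a) <? m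
...   | yes _   = trans (cong (a +_) (position-nth F (Tracks.gaps-decreasing T) j<L)) (m+[n∸m]≡n a≤c)
  where j<L = offset<length-gaps T a≤c c<m
...   | no  y≮m = ⊥-elim (y≮m (All.lookup (Tracks.gaps<top T) (nth-∈ F (offset<length-gaps T a≤c c<m))))

position-gap : ∀ {r o : Vec ℕ n} {m a F y} → Tracks r o (state m a F) → y < m →
               ¬ Completes PatternB o y → nth F (position y F) ≡ y × a + position y F < m
position-gap {a = a} {F} T y<m ¬q with nth-position F (Tracks.¬completes⇒gap T y<m ¬q)
... | nth≡y , pos<L = nth≡y , subst (a + position _ F <_) (Tracks.floor+gaps≡top T) (+-monoʳ-< a pos<L)

decode-admissible : ∀ {r o : Vec ℕ n} s {y} → Tracks r o s → top s ≤ n → y ≤ n →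
                    ¬ Completes PatternB o y → decode s y ≤ n × floor s ≤ decode s y
decode-admissible (state m a F) {y} T m≤n y≤n ¬q with y <? m
... | yes y<m = <⇒≤ (<-≤-trans (proj₂ (position-gap T y<m ¬q)) m≤n) , m≤m+n a _
... | no  y≮m = y≤n , ≤-trans (subst (a ≤_) (Tracks.floor+gaps≡top T) (m≤m+n a _)) (≮⇒≥ y≮m)

encode-decode : ∀ {r o : Vec ℕ n} s {y} → Tracks r o s → ¬ Completes PatternB o y →
                encode s (decode s y) ≡ y
encode-decode (state m a F) {y} T ¬q with y <? m
... | no y≮m with y <? m
...   | yes y<m = ⊥-elim (y≮m y<m)
...   | no  _   = refl
encode-decode (state m a F) {y} T ¬q | yes y<m with a + position y F <? m | position-gap T y<m ¬q
...   | yes _   | nth≡y , _ = trans (cong (nth F) (m+n∸m≡n a (position y F))) nth≡y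
...   | no  x≮m | _ , x<m = ⊥-elim (x≮m x<m)

floor≤admissible : ∀ {r o : Vec ℕ n} s {c} → Tracks r o s → ¬ Completes Weak210 r c → floor s ≤ c
floor≤admissible s T ¬q = ≮⇒≥ (¬q ∘ Tracks.<floor⇒completes T)

toB-tracks : ∀ (r : Vec ℕ n) → Avoiding Weak210 r →
             Tracks r (toB r) (stateOf r) × Avoiding PatternB (toB r)
toB-tracks []      _ = tracks-[] , tt
toB-tracks {suc n} (c ∷ r) (c≤n , ¬q , av) with toB-tracks r av
... | T , avᴮ = tracks-step s T a≤c , proj₁ y-admissible , proj₂ y-admissible , avᴮ
  where
  s = stateOf r
  a≤c = floor≤admissible s T ¬q
  m≤n = subst (_≤ n) (sym (Tracks.top≡heightʳ T)) (avoiding⇒height≤ Weak210 r av)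
  y-admissible = encode-admissible s T a≤c m≤n c≤n

to210-tracks : ∀ (o : Vec ℕ n) → Avoiding PatternB o →
               Tracks (to210 o) o (stateOf (to210 o)) × Avoiding Weak210 (to210 o)
to210-tracks []      _ = tracks-[] , tt
to210-tracks {suc n} (y ∷ o) (y≤n , ¬q , av) with to210-tracks o av
... | T , av²¹⁰ =
  subst (λ t → Tracks (x ∷ to210 o) (t ∷ o) (step s x)) (encode-decode s T ¬q) (tracks-step s T a≤x) ,
  (x≤n , (λ q → <⇒≱ (Tracks.completes⇒<floor T q) a≤x) , av²¹⁰)
  where
  s = stateOf (to210 o)
  x = decode s y
  m≤n = subst (_≤ n) (sym (Tracks.top≡heightᵒ T)) (avoiding⇒height≤ PatternB o av)
  x≤n = proj₁ (decode-admissible s T m≤n y≤n ¬q)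
  a≤x = proj₂ (decode-admissible s T m≤n y≤n ¬q)

to210-toB : ∀ (r : Vec ℕ n) → Avoiding Weak210 r → to210 (toB r) ≡ r
to210-toB []      _              = refl
to210-toB (c ∷ r) (_ , ¬q , av) rewrite to210-toB r av =
  cong (_∷ r) (decode-encode (stateOf r) T (floor≤admissible (stateOf r) T ¬q))
  where T = proj₁ (toB-tracks r av)

toB-to210 : ∀ (o : Vec ℕ n) → Avoiding PatternB o → toB (to210 o) ≡ o
toB-to210 []      _              = refl
toB-to210 (y ∷ o) (_ , ¬q , av) rewrite toB-to210 o av =
  cong (_∷ o) (encode-decode (stateOf (to210 o)) (proj₁ (to210-tracks o av)) ¬q)

rev-conjugate-avoiding : ∀ R S (f : Vec ℕ n → Vec ℕ n) → (∀ r → Avoiding R r → Avoiding S (f r)) →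
                         ∀ e → IsInvSeq e → ¬ Occurs R e →
                         IsInvSeq (rev (f (rev e))) × ¬ Occurs S (rev (f (rev e)))
rev-conjugate-avoiding R S f f-avoids e i p = rev-avoiding S (f (rev e)) (f-avoids (rev e) (avoiding-rev R e i p))

mk-cong : ∀ {P : Vec ℕ n → Set} {e e′ : Vec ℕ n} .{i i′ p p′} → e ≡ e′ →
          _≡_ {A = InvSeqWith n P} (mk e i p) (mk e′ i′ p′)
mk-cong refl = refl

rev-conjugate-inverse : ∀ (f g : Vec ℕ n → Vec ℕ n) e → g (f (rev e)) ≡ rev e →
                        rev (g (rev (rev (f (rev e))))) ≡ e
rev-conjugate-inverse f g e gf≡ = begin
  rev (g (rev (rev (f (rev e))))) ≡⟨ cong (rev ∘ g) (rev-involutive (f (rev e))) ⟩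
  rev (g (f (rev e)))             ≡⟨ cong rev gf≡ ⟩
  rev (rev e)                     ≡⟨ rev-involutive e ⟩
  e                               ∎
  where open ≡-Reasoning

-- The avoidance proofs are irrelevant, so each inverse law is first obtained in an irrelevant
-- position and then recomputed from decidability of equality of vectors.
avoiders-↔ : ∀ R S (f g : Vec ℕ n → Vec ℕ n) →
             (∀ r → Avoiding R r → Avoiding S (f r)) → (∀ o → Avoiding S o → Avoiding R (g o)) →
             (∀ r → Avoiding R r → g (f r) ≡ r) → (∀ o → Avoiding S o → f (g o) ≡ o) →
             InvSeqWith n (λ e → ¬ Occurs R e) ↔ InvSeqWith n (λ e → ¬ Occurs S e)
avoiders-↔ {n} R S f g f-avoids g-avoids g∘f f∘g = mk↔ₛ′ to from to∘from from∘to
  where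
  f-ok = rev-conjugate-avoiding R S f f-avoids
  g-ok = rev-conjugate-avoiding S R g g-avoids
  to : InvSeqWith n (λ e → ¬ Occurs R e) → InvSeqWith n (λ e → ¬ Occurs S e)
  to (mk e i p) = mk (rev (f (rev e))) (proj₁ (f-ok e i p)) (proj₂ (f-ok e i p))
  from : InvSeqWith n (λ e → ¬ Occurs S e) → InvSeqWith n (λ e → ¬ Occurs R e)
  from (mk e i p) = mk (rev (g (rev e))) (proj₁ (g-ok e i p)) (proj₂ (g-ok e i p))
  to∘from : ∀ x → to (from x) ≡ x
  to∘from (mk e i p) = mk-cong (recompute (≡-dec _≟_ _ e)
    (rev-conjugate-inverse g f e (f∘g (rev e) (avoiding-rev S e i p))))
  from∘to : ∀ x → from (to x) ≡ x
  from∘to (mk e i p) = mk-cong (recompute (≡-dec _≟_ _ e)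
    (rev-conjugate-inverse f g e (g∘f (rev e) (avoiding-rev R e i p))))

mainTheorem11 : (n : ℕ) → n ≥ 1 → Avoid210 n ↔ AvoidB n
mainTheorem11 n _ = avoiders-↔ Weak210 PatternB toB to210
  (λ r → proj₂ ∘ toB-tracks r) (λ o → proj₂ ∘ to210-tracks o) to210-toB toB-to210
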